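{- Let $G$ be a directed graph, $s\in V(G)$ a source vertex, and $k\ge 0$, $\lambda\ge 1$ integers. Let $H$ be a $(k+\lambda-1)$-FTRS of $G$ with respect to $s$. Then $H$ is also a $(\lambda,k)$-FTRS of $G$ with respect to $s$.
   Context: For a set $F$ of edges, $G-F$ is the graph with vertex set $V(G)$ and edge set $E(G)\setminus F$. A spanning subgraph $H$ of $G$ is a $t$-FTRS of $G$ w.r.t. $s$ if for every set $F$ of at most $t$ edges of $G$ and every vertex $w$, there is a directed path from $s$ to $w$ in $G-F$ iff there is one in $H-F$. $H$ is a $(\lambda,k)$-FTRS of $G$ w.r.t. $s$ if for every set $F$ of at most $k$ edges of $G$ and every vertex $v$, there are $\lambda$ pairwise edge-disjoint directed paths from $s$ to $v$ in $G-F$ iff there are $\lambda$ such paths in $H-F$. -}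

module Defs where

open import Data.Nat using (ℕ; _≤_)
open import Data.Fin using (Fin)
open import Data.Bool using (Bool; true)
open import Data.Product using (Σ; ∃; _×_; _,_)
open import Data.List using (List; []; _∷_; length)
open import Data.List.Membership.Propositional using (_∈_)
open import Data.List.Relation.Unary.All using (All)
open import Data.List.Relation.Unary.Unique.Propositional using (Unique)
open import Relation.Nullary using (¬_)
open import Relation.Binary.PropositionalEquality using (_≡_)
open import Data.Empty using (⊥)

Digraph : ℕ → Set
Digraph n = Fin n → Fin n → Bool

Edge : ℕ → Set
Edge n = Fin n × Fin n

_∈E_ : ∀ {n} → Edge n → Digraph n → Set
(u , v) ∈E G = G u v ≡ true

_⊆G_ : ∀ {n} → Digraph n → Digraph n → Set
H ⊆G G = ∀ u v → (u , v) ∈E H → (u , v) ∈E G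

EdgeOfMinus : ∀ {n} → Digraph n → List (Edge n) → Fin n → Fin n → Set
EdgeOfMinus G F u v = ((u , v) ∈E G) × ¬ ((u , v) ∈ F)

data Walk {n} (R : Fin n → Fin n → Set) : Fin n → Fin n → Set where
  nil  : ∀ {u} → Walk R u u
  cons : ∀ {u w v} → R u w → Walk R w v → Walk R u v

verts : ∀ {n} {R : Fin n → Fin n → Set} {u v} → Walk R u v → List (Fin n)
verts {u = u} nil = u ∷ []
verts {u = u} (cons _ p) = u ∷ verts p

edges : ∀ {n} {R : Fin n → Fin n → Set} {u v} → Walk R u v → List (Edge n)
edges nil = []
edges {u = u} (cons {w = w} _ p) = (u , w) ∷ edges p

Path : ∀ {n} → Digraph n → List (Edge n) → Fin n → Fin n → Set
Path G F u v = Σ (Walk (EdgeOfMinus G F) u v) (λ p → Unique (verts p))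

Reach : ∀ {n} → Digraph n → List (Edge n) → Fin n → Fin n → Set
Reach G F s w = Path G F s w

EdgeDisjoint : ∀ {n} {G : Digraph n} {F u v} → Path G F u v → Path G F u v → Set
EdgeDisjoint (p , _) (q , _) = ∀ e → e ∈ edges p → e ∈ edges q → ⊥

DisjPaths : ∀ {n} → ℕ → Digraph n → List (Edge n) → Fin n → Fin n → Set
DisjPaths l G F s v =
  Σ (Fin l → Path G F s v) λ P → ∀ i j → ¬ (i ≡ j) → EdgeDisjoint (P i) (P j)

-- F is a set of at most t edges of G (a list of edges of G of length ≤ t;
-- repetitions are harmless)
FaultSet : ∀ {n} → ℕ → Digraph n → List (Edge n) → Set
FaultSet t G F = (length F ≤ t) × All (λ e → e ∈E G) F

FTRS : ∀ {n} → ℕ → Digraph n → Digraph n → Fin n → Set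
FTRS t G H s = (H ⊆G G) × (∀ F → FaultSet t G F → ∀ w →
  (Reach G F s w → Reach H F s w) × (Reach H F s w → Reach G F s w))

LFTRS : ∀ {n} → ℕ → ℕ → Digraph n → Digraph n → Fin n → Set
LFTRS l k G H s = (H ⊆G G) × (∀ F → FaultSet k G F → ∀ v →
  (DisjPaths l G F s v → DisjPaths l H F s v) × (DisjPaths l H F s v → DisjPaths l G F s v))

-- One direction holds because H is a subgraph of G. For the other, fix faults F
-- (|F| ≤ k) and λ edge-disjoint s–v paths in G − F. By Menger's theorem it
-- suffices that no set C of fewer than λ edges of H − F separates s from v.
-- One of the λ paths avoids C, so v is reachable in G − (F ∪ C); as
-- |F ∪ C| ≤ k + λ − 1, the FTRS property makes v reachable in H − (F ∪ C).
--
-- Menger's theorem is proved by augmenting paths. Given j < λ disjoint paths,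
-- either the residual graph of their union contains an s–v path, and the
-- augmented flow of value j + 1 decomposes into j + 1 disjoint paths, or the
-- vertices reachable from s form a set that each path leaves exactly once, and
-- the j exit edges would separate s from v.
module Submission where

open import Algebra.Properties.Monoid.Sum using (sum; sum-cong-≗; sum-replicate-zero)
open import Data.Bool using (Bool; true; false)
open import Data.Bool.Properties using (¬-not; not-¬) renaming (_≟_ to _≟ᴮ_)
open import Data.Empty using (⊥; ⊥-elim)
open import Data.Fin using (Fin; zero; suc; _≟_)
open import Data.Fin.Properties
  using (suc-injective; injective⇒≤; any?; all?; ¬∀⟶∃¬; pigeonhole; <⇒≢)
open import Data.List using (List; []; _∷_; _++_; length; lookup; tabulate)
open import Data.List.Membership.Propositional using (_∈_; lose)
open import Data.List.Membership.Propositional.Properties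
  using (∈-lookup; ∈-tabulate⁺; ∈-tabulate⁻; ∈-++⁻; ∈-++⁺ˡ; ∈-++⁺ʳ)
open import Data.List.Properties using (length-tabulate; length-++)
open import Data.List.Relation.Binary.Subset.Propositional using (_⊆_)
open import Data.List.Relation.Unary.All as All using (All; []; _∷_)
open import Data.List.Relation.Unary.All.Properties using (¬Any⇒All¬; All¬⇒¬Any; ++⁺)
open import Data.List.Relation.Unary.AllPairs using ([]; _∷_)
open import Data.List.Relation.Unary.Any as Any using (Any; here; there) renaming (any? to anyᴸ?)
open import Data.List.Relation.Unary.Any.Properties using (lookup-index)
open import Data.List.Relation.Unary.Unique.Propositional using (Unique)
open import Data.Nat using (ℕ; zero; suc; _+_; _*_; _∸_; _≤_; _<_; z≤n; s≤s; s≤s⁻¹)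
open import Data.Nat.Properties
  using ( +-0-monoid; +-commutativeSemigroup; +-comm; +-assoc; +-identityʳ; *-zeroʳ; *-identityʳ
        ; +-cancelʳ-≡; +-∸-assoc; +-mono-≤; +-mono-<-≤; +-mono-≤-<; m≤m+n; m≤n+m; m<m+n
        ; ≤-refl; <⇒≤; <-irrefl; <-≤-trans; module ≤-Reasoning )
open import Algebra.Properties.CommutativeSemigroup +-commutativeSemigroup using (xy∙z≈xz∙y)
open import Data.Nat.Tactic.RingSolver using (solve-∀)
open import Data.Product as Product using (Σ; ∃; _×_; _,_; proj₁; proj₂)
open import Data.Product.Properties using (≡-dec)
open import Data.Sum as Sum using (_⊎_; inj₁; inj₂)
open import Function using (_∘_; id)
open import Function.Definitions using (Injective)
open import Level using (0ℓ)
open import Relation.Binary using (Rel)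
open import Relation.Binary.PropositionalEquality
open import Relation.Nullary using (¬_; Dec; yes; no; does; _×-dec_; _⊎-dec_)
open import Relation.Nullary.Decidable using (map′; ¬?)
open import Relation.Unary using (Decidable)

open import Defs

private
  variable
    n m : ℕ

sumℕ : (Fin m → ℕ) → ℕ
sumℕ = sum +-0-monoid

sum-mono-≤ : {f g : Fin m → ℕ} → (∀ i → f i ≤ g i) → sumℕ f ≤ sumℕ g
sum-mono-≤ {zero} le = z≤n
sum-mono-≤ {suc m} le = +-mono-≤ (le zero) (sum-mono-≤ (λ i → le (suc i)))

sum-mono-< : {f g : Fin m → ℕ} → (∀ i → f i ≤ g i) → ∀ j → f j < g j → sumℕ f < sumℕ g
sum-mono-< {suc m} le zero lt = +-mono-<-≤ lt (sum-mono-≤ (λ i → le (suc i)))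
sum-mono-< {suc m} le (suc j) lt = +-mono-≤-< (le zero) (sum-mono-< (λ i → le (suc i)) j lt)

sum-update : {f g : Fin m → ℕ} (j : Fin m) → (∀ i → i ≢ j → f i ≡ g i) →
             sumℕ f + g j ≡ sumℕ g + f j
sum-update {suc m} {f} {g} zero agree =
  begin
    f zero + sumℕ (λ i → f (suc i)) + g zero
  ≡⟨ cong (λ t → f zero + t + g zero) (sum-cong-≗ +-0-monoid (λ i → agree (suc i) λ ())) ⟩
    f zero + sumℕ (λ i → g (suc i)) + g zero
  ≡⟨ swap (f zero) _ (g zero) ⟩
    g zero + sumℕ (λ i → g (suc i)) + f zero
  ∎
  where
    open ≡-Reasoning
    swap : ∀ a b c → a + b + c ≡ c + b + a
    swap = solve-∀
sum-update {suc m} {f} {g} (suc j) agree =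
  begin
    f zero + sumℕ (λ i → f (suc i)) + g (suc j)
  ≡⟨ +-assoc (f zero) _ _ ⟩
    f zero + (sumℕ (λ i → f (suc i)) + g (suc j))
  ≡⟨ cong₂ _+_ (agree zero λ ()) (sum-update j (λ i i≢j → agree (suc i) (i≢j ∘ suc-injective))) ⟩
    g zero + (sumℕ (λ i → g (suc i)) + f (suc j))
  ≡⟨ +-assoc (g zero) _ _ ⟨
    g zero + sumℕ (λ i → g (suc i)) + f (suc j)
  ∎
  where open ≡-Reasoning

_≟E_ : (d e : Edge n) → Dec (d ≡ e)
_≟E_ = ≡-dec _≟_ _≟_

_∉E_ : Edge n → Digraph n → Set
(u , v) ∉E g = g u v ≡ false

bit : Bool → ℕ
bit false = 0
bit true = 1

δ : Fin n → Fin n → ℕ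
δ a x = bit (does (a ≟ x))

δ-refl : (a : Fin n) → δ a a ≡ 1
δ-refl a with a ≟ a
... | yes _ = refl
... | no a≢a = ⊥-elim (a≢a refl)

δ-≢ : {a x : Fin n} → a ≢ x → δ a x ≡ 0
δ-≢ {a = a} {x} a≢x with a ≟ x
... | yes a≡x = ⊥-elim (a≢x a≡x)
... | no _ = refl

_[_]≔_ : Digraph n → Edge n → Bool → Digraph n
(g [ e ]≔ c) x y with (x , y) ≟E e
... | yes _ = c
... | no _ = g x y

[]≔-same : (g : Digraph n) (a b : Fin n) (c : Bool) → (g [ (a , b) ]≔ c) a b ≡ c
[]≔-same g a b c with (a , b) ≟E (a , b)
... | yes _ = refl
... | no ab≢ab = ⊥-elim (ab≢ab refl)

[]≔-other : (g : Digraph n) {e : Edge n} {c : Bool} {x y : Fin n} → (x , y) ≢ e →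
            (g [ e ]≔ c) x y ≡ g x y
[]≔-other g {e} {x = x} {y} xy≢e with (x , y) ≟E e
... | yes xy≡e = ⊥-elim (xy≢e xy≡e)
... | no _ = refl

module _ {g : Digraph n} {e : Edge n} where

  ∈E-insert⁻ : ∀ d → d ∈E (g [ e ]≔ true) → d ≡ e ⊎ d ∈E g
  ∈E-insert⁻ (x , y) xy∈g′ with (x , y) ≟E e
  ... | yes xy≡e = inj₁ xy≡e
  ... | no _ = inj₂ xy∈g′

  ∈E-insert⁺ : ∀ d → d ≡ e ⊎ d ∈E g → d ∈E (g [ e ]≔ true)
  ∈E-insert⁺ (x , y) _ with (x , y) ≟E e
  ∈E-insert⁺ _ _ | yes _ = refl
  ∈E-insert⁺ _ (inj₁ xy≡e) | no xy≢e = ⊥-elim (xy≢e xy≡e)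
  ∈E-insert⁺ _ (inj₂ xy∈g) | no _ = xy∈g

_⊆E_ : Digraph n → Rel (Fin n) 0ℓ → Set
g ⊆E R = ∀ {x y} → (x , y) ∈E g → R x y

delete-⊆ : (g : Digraph n) (e : Edge n) → (g [ e ]≔ false) ⊆G g
delete-⊆ g e x y xy∈g′ with (x , y) ≟E e
... | no _ = xy∈g′

outdeg indeg : Digraph n → Fin n → ℕ
outdeg g x = sumℕ (λ y → bit (g x y))
indeg g x = sumℕ (λ y → bit (g y x))

outdeg-[]≔ : (g : Digraph n) (a b : Fin n) (c : Bool) (x : Fin n) →
             outdeg (g [ (a , b) ]≔ c) x + δ a x * bit (g a b) ≡ outdeg g x + δ a x * bit c
outdeg-[]≔ g a b c x with a ≟ x
... | no a≢x =
  cong (_+ 0) (sum-cong-≗ +-0-monoid λ y →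
    cong bit ([]≔-other g {x = x} {y} λ xy≡ab → a≢x (sym (cong proj₁ xy≡ab))))
... | yes refl rewrite +-identityʳ (bit (g a b)) | +-identityʳ (bit c) =
  begin
    outdeg (g [ (a , b) ]≔ c) a + bit (g a b)
  ≡⟨ sum-update b (λ y y≢b → cong bit ([]≔-other g {x = a} {y} λ ay≡ab → y≢b (cong proj₂ ay≡ab))) ⟩
    outdeg g a + bit ((g [ (a , b) ]≔ c) a b)
  ≡⟨ cong (λ t → outdeg g a + bit t) ([]≔-same g a b c) ⟩
    outdeg g a + bit c
  ∎
  where open ≡-Reasoning

indeg-[]≔ : (g : Digraph n) (a b : Fin n) (c : Bool) (x : Fin n) →
            indeg (g [ (a , b) ]≔ c) x + δ b x * bit (g a b) ≡ indeg g x + δ b x * bit c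
indeg-[]≔ g a b c x with b ≟ x
... | no b≢x =
  cong (_+ 0) (sum-cong-≗ +-0-monoid λ y →
    cong bit ([]≔-other g {x = y} {x} λ yx≡ab → b≢x (sym (cong proj₂ yx≡ab))))
... | yes refl rewrite +-identityʳ (bit (g a b)) | +-identityʳ (bit c) =
  begin
    indeg (g [ (a , b) ]≔ c) b + bit (g a b)
  ≡⟨ sum-update a (λ y y≢a → cong bit ([]≔-other g {x = y} {b} λ yb≡ab → y≢a (cong proj₁ yb≡ab))) ⟩
    indeg g b + bit ((g [ (a , b) ]≔ c) a b)
  ≡⟨ cong (λ t → indeg g b + bit t) ([]≔-same g a b c) ⟩
    indeg g b + bit c
  ∎
  where open ≡-Reasoning

insert-count : ∀ {k k′ d β} → β ≡ false → k′ + d * bit β ≡ k + d * 1 → k′ ≡ k + d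
insert-count {k} {k′} {d} refl eq rewrite *-zeroʳ d | *-identityʳ d | +-identityʳ k′ = eq

delete-count : ∀ {k k′ d β} → β ≡ true → k′ + d * bit β ≡ k + d * 0 → k ≡ k′ + d
delete-count {k} {k′} {d} refl eq rewrite *-zeroʳ d | *-identityʳ d | +-identityʳ k = sym eq

outdeg-insert : {g : Digraph n} {a b : Fin n} → (a , b) ∉E g → ∀ x →
                outdeg (g [ (a , b) ]≔ true) x ≡ outdeg g x + δ a x
outdeg-insert {g = g} {a} {b} ab∉g x =
  insert-count {k = outdeg g x} ab∉g (outdeg-[]≔ g a b true x)

indeg-insert : {g : Digraph n} {a b : Fin n} → (a , b) ∉E g → ∀ x →
               indeg (g [ (a , b) ]≔ true) x ≡ indeg g x + δ b x
indeg-insert {g = g} {a} {b} ab∉g x =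
  insert-count {k = indeg g x} ab∉g (indeg-[]≔ g a b true x)

outdeg-delete : {g : Digraph n} {a b : Fin n} → (a , b) ∈E g → ∀ x →
                outdeg g x ≡ outdeg (g [ (a , b) ]≔ false) x + δ a x
outdeg-delete {g = g} {a} {b} ab∈g x =
  delete-count {k′ = outdeg (g [ (a , b) ]≔ false) x} ab∈g (outdeg-[]≔ g a b false x)

indeg-delete : {g : Digraph n} {a b : Fin n} → (a , b) ∈E g → ∀ x →
               indeg g x ≡ indeg (g [ (a , b) ]≔ false) x + δ b x
indeg-delete {g = g} {a} {b} ab∈g x =
  delete-count {k′ = indeg (g [ (a , b) ]≔ false) x} ab∈g (indeg-[]≔ g a b false x)

size : Digraph n → ℕ
size g = sumℕ (outdeg g)

delete-shrinks : {g : Digraph n} {a b : Fin n} → (a , b) ∈E g → size (g [ (a , b) ]≔ false) < size g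
delete-shrinks {g = g} {a} {b} ab∈g =
  sum-mono-< {f = outdeg g′} {g = outdeg g}
    (λ x → subst (outdeg g′ x ≤_) (shrink x) (m≤m+n (outdeg g′ x) (δ a x))) a
    (subst (outdeg g′ a <_) (shrink a) (m<m+n (outdeg g′ a) (subst (0 <_) (sym (δ-refl a)) (s≤s z≤n))))
  where
    g′ = g [ (a , b) ]≔ false
    shrink : ∀ x → outdeg g′ x + δ a x ≡ outdeg g x
    shrink x = sym (outdeg-delete {g = g} ab∈g x)

out-neighbour : (g : Digraph n) (a : Fin n) → 0 < outdeg g a → ∃ λ y → (a , y) ∈E g
out-neighbour {n} g a pos with any? (λ y → g a y ≟ᴮ true)
... | yes found = found
... | no none = ⊥-elim (<-irrefl (sym noOutdeg) pos)
  where
    noOutdeg : outdeg g a ≡ 0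
    noOutdeg = trans (sum-cong-≗ +-0-monoid (λ y → cong bit (¬-not (λ ay∈g → none (y , ay∈g)))))
                     (sum-replicate-zero +-0-monoid n)

-- p x is the supply and q x the demand at vertex x.
Balanced : Digraph n → (Fin n → ℕ) → (Fin n → ℕ) → Set
Balanced g p q = ∀ x → outdeg g x + q x ≡ indeg g x + p x

_+δ_ : (Fin n → ℕ) → Fin n → Fin n → ℕ
(p +δ a) x = p x + δ a x

_·δ_ : ℕ → Fin n → Fin n → ℕ
(c ·δ a) x = c * δ a x

private
  trade : ∀ i p e d → i + (p + e) + d ≡ i + e + (p + d)
  trade = solve-∀

IsFlow : Fin n → Fin n → ℕ → Digraph n → Set
IsFlow s v c g = Balanced g (c ·δ s) (c ·δ v)

module _ {g : Digraph n} where

  balanced-cong : {p p′ q q′ : Fin n → ℕ} → p ≗ p′ → q ≗ q′ → Balanced g p q → Balanced g p′ q′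
  balanced-cong p≗p′ q≗q′ bal x =
    subst₂ (λ s t → outdeg g x + s ≡ indeg g x + t) (q≗q′ x) (p≗p′ x) (bal x)

  balanced-+δ : {p q : Fin n → ℕ} (a : Fin n) → Balanced g p q → Balanced g (p +δ a) (q +δ a)
  balanced-+δ {p} {q} a bal x = begin
    outdeg g x + (q x + δ a x)  ≡⟨ +-assoc (outdeg g x) _ _ ⟨
    outdeg g x + q x + δ a x    ≡⟨ cong (_+ δ a x) (bal x) ⟩
    indeg g x + p x + δ a x     ≡⟨ +-assoc (indeg g x) _ _ ⟩
    indeg g x + (p x + δ a x)   ∎
    where open ≡-Reasoning

  balanced-cancelδ : {p q : Fin n → ℕ} (a : Fin n) → Balanced g (p +δ a) (q +δ a) → Balanced g p q
  balanced-cancelδ {p} {q} a bal x = +-cancelʳ-≡ (δ a x) _ _ (begin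
    outdeg g x + q x + δ a x    ≡⟨ +-assoc (outdeg g x) _ _ ⟩
    outdeg g x + (q x + δ a x)  ≡⟨ bal x ⟩
    indeg g x + (p x + δ a x)   ≡⟨ +-assoc (indeg g x) _ _ ⟨
    indeg g x + p x + δ a x     ∎)
    where open ≡-Reasoning

  balanced-insert : {p q : Fin n → ℕ} {a b : Fin n} → (a , b) ∉E g →
                    Balanced g (p +δ b) q → Balanced (g [ (a , b) ]≔ true) (p +δ a) q
  balanced-insert {p} {q} {a} {b} ab∉g bal x = begin
    outdeg (g [ (a , b) ]≔ true) x + q x  ≡⟨ cong (_+ q x) (outdeg-insert ab∉g x) ⟩
    outdeg g x + δ a x + q x              ≡⟨ xy∙z≈xz∙y (outdeg g x) _ _ ⟩
    outdeg g x + q x + δ a x              ≡⟨ cong (_+ δ a x) (bal x) ⟩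
    indeg g x + (p x + δ b x) + δ a x     ≡⟨ trade (indeg g x) _ _ _ ⟩
    indeg g x + δ b x + (p x + δ a x)     ≡⟨ cong (_+ (p x + δ a x)) (indeg-insert ab∉g x) ⟨
    indeg (g [ (a , b) ]≔ true) x + (p x + δ a x) ∎
    where open ≡-Reasoning

  balanced-delete : {p q : Fin n → ℕ} {a b : Fin n} → (a , b) ∈E g →
                    Balanced g (p +δ a) q → Balanced (g [ (a , b) ]≔ false) (p +δ b) q
  balanced-delete {p} {q} {a} {b} ab∈g bal x = +-cancelʳ-≡ (δ a x) _ _ (begin
    outdeg g′ x + q x + δ a x          ≡⟨ xy∙z≈xz∙y (outdeg g′ x) _ _ ⟩
    outdeg g′ x + δ a x + q x          ≡⟨ cong (_+ q x) (outdeg-delete ab∈g x) ⟨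
    outdeg g x + q x                   ≡⟨ bal x ⟩
    indeg g x + (p x + δ a x)          ≡⟨ cong (_+ (p x + δ a x)) (indeg-delete ab∈g x) ⟩
    indeg g′ x + δ b x + (p x + δ a x) ≡⟨ trade (indeg g′ x) _ _ _ ⟨
    indeg g′ x + (p x + δ b x) + δ a x ∎)
    where
      g′ = g [ (a , b) ]≔ false
      open ≡-Reasoning

isFlow-suc : {g g′ : Digraph n} {s v : Fin n} {c : ℕ} →
             (∀ {p q} → Balanced g (p +δ v) q → Balanced g′ (p +δ s) q) →
             IsFlow s v c g → IsFlow s v (suc c) g′
isFlow-suc {s = s} {v} {c} extend flow =
  balanced-cong (λ x → +-comm (c * δ s x) (δ s x)) (λ x → +-comm (c * δ v x) (δ v x))
    (extend (balanced-+δ v flow))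

balanced-source-emits : {g : Digraph n} {p q : Fin n → ℕ} → Balanced g p q →
                        ∀ a → q a ≡ 0 → 0 < p a → 0 < outdeg g a
balanced-source-emits {g = g} {p} {q} bal a noDemand supply = begin-strict
  0                    <⟨ supply ⟩
  p a                  ≤⟨ m≤n+m (p a) (indeg g a) ⟩
  indeg g a + p a      ≡⟨ bal a ⟨
  outdeg g a + q a     ≡⟨ cong (outdeg g a +_) noDemand ⟩
  outdeg g a + 0       ≡⟨ +-identityʳ _ ⟩
  outdeg g a           ∎
  where open ≤-Reasoning

module _ {R : Rel (Fin n) 0ℓ} where

  ∈-edges⇒R : ∀ {u v} (p : Walk R u v) {e} → e ∈ edges p → R (proj₁ e) (proj₂ e)
  ∈-edges⇒R (cons r p) (here refl) = r
  ∈-edges⇒R (cons r p) (there e∈p) = ∈-edges⇒R p e∈p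

  ∈-edges⇒∈-verts : ∀ {u v} (p : Walk R u v) {e} → e ∈ edges p → proj₁ e ∈ verts p
  ∈-edges⇒∈-verts (cons r p) (here refl) = here refl
  ∈-edges⇒∈-verts (cons r p) (there e∈p) = there (∈-edges⇒∈-verts p e∈p)

  start∈verts : ∀ {u v} (p : Walk R u v) → u ∈ verts p
  start∈verts nil = here refl
  start∈verts (cons _ _) = here refl

  ∉-verts-cons : ∀ {x u w v} (r : R u w) (p : Walk R w v) → ¬ x ∈ verts (cons r p) → x ≢ u × x ≢ w
  ∉-verts-cons r p x∉ = x∉ ∘ here , λ { refl → x∉ (there (start∈verts p)) }

  _▷_ : ∀ {u w t} → Walk R u w → R w t → Walk R u t
  nil ▷ r = cons r nil
  cons r′ p ▷ r = cons r′ (p ▷ r)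

SimplePath : Rel (Fin n) 0ℓ → Fin n → Fin n → Set
SimplePath R u v = Σ (Walk R u v) (λ p → Unique (verts p))

module _ {R R′ : Rel (Fin n) 0ℓ} where

  retype : ∀ {u v} (p : Walk R u v) → (∀ {x y} → (x , y) ∈ edges p → R′ x y) → Walk R′ u v
  retype nil _ = nil
  retype (cons r p) steps = cons (steps (here refl)) (retype p (steps ∘ there))

  retype-verts : ∀ {u v} (p : Walk R u v) (steps : ∀ {x y} → (x , y) ∈ edges p → R′ x y) →
                 verts (retype p steps) ≡ verts p
  retype-verts nil _ = refl
  retype-verts {u} (cons r p) steps = cong (u ∷_) (retype-verts p (steps ∘ there))

  retype-edges : ∀ {u v} (p : Walk R u v) (steps : ∀ {x y} → (x , y) ∈ edges p → R′ x y) →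
                 edges (retype p steps) ≡ edges p
  retype-edges nil _ = refl
  retype-edges {u} (cons {w = w} r p) steps = cong ((u , w) ∷_) (retype-edges p (steps ∘ there))

  retypePath : ∀ {u v} ((p , _) : SimplePath R u v) →
               (∀ {x y} → (x , y) ∈ edges p → R′ x y) → SimplePath R′ u v
  retypePath (p , up) steps = retype p steps , subst Unique (sym (retype-verts p steps)) up

module _ {R : Rel (Fin n) 0ℓ} where

  suffix : ∀ {u w v} (q : Walk R w v) → Unique (verts q) → u ∈ verts q →
           Σ (SimplePath R u v) (λ q′ → edges (proj₁ q′) ⊆ edges q)
  suffix nil uq (here refl) = (nil , uq) , id
  suffix (cons r q) uq (here refl) = (cons r q , uq) , id
  suffix (cons r q) (_ ∷ uq) (there u∈q) =
    let (q′ , q′⊆q) = suffix q uq u∈q in q′ , there ∘ q′⊆q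

  simplify : ∀ {u v} (p : Walk R u v) → Σ (SimplePath R u v) (λ q → edges (proj₁ q) ⊆ edges p)
  simplify nil = (nil , [] ∷ []) , id
  simplify (cons {u} {w} {v} r p) with simplify p
  ... | (q , uq) , q⊆p = shortcut (anyᴸ? (u ≟_) (verts q))
    where
      shortcut : Dec (u ∈ verts q) → Σ (SimplePath R u v) (λ q′ → edges (proj₁ q′) ⊆ edges (cons r p))
      shortcut (yes u∈q) = let (q′ , q′⊆q) = suffix q uq u∈q in q′ , there ∘ q⊆p ∘ q′⊆q
      shortcut (no u∉q) =
        (cons r q , ¬Any⇒All¬ _ u∉q ∷ uq) , λ { (here e≡) → here e≡ ; (there e∈q) → there (q⊆p e∈q) }

PairwiseEdgeDisjoint : {R : Rel (Fin n) 0ℓ} {u v : Fin n} → (Fin m → Walk R u v) → Set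
PairwiseEdgeDisjoint P = ∀ i j → i ≢ j → ∀ e → e ∈ edges (P i) → e ∈ edges (P j) → ⊥

DisjointPaths : Rel (Fin n) 0ℓ → Fin n → Fin n → ℕ → Set
DisjointPaths R u v c = Σ (Fin c → SimplePath R u v) λ P → PairwiseEdgeDisjoint (proj₁ ∘ P)

module _ {R : Rel (Fin n) 0ℓ} {u v : Fin n} where

  simplify-disjoint : ∀ {c} (W : Fin c → Walk R u v) → PairwiseEdgeDisjoint W → DisjointPaths R u v c
  simplify-disjoint W disjoint =
    (λ i → proj₁ (simplify (W i))) ,
    λ i j i≢j e e∈i e∈j → disjoint i j i≢j e (proj₂ (simplify (W i)) e∈i) (proj₂ (simplify (W j)) e∈j)

module _ {R : Rel (Fin n) 0ℓ} {u v : Fin n} where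

  meets? : (C : List (Edge n)) (p : Walk R u v) → Dec (Any (_∈ edges p) C)
  meets? C p = anyᴸ? (λ c → anyᴸ? (c ≟E_) (edges p)) C

  some-walk-avoids : ∀ {l} (W : Fin l → Walk R u v) → PairwiseEdgeDisjoint W →
                     (C : List (Edge n)) → length C < l → ∃ λ i → ∀ {e} → e ∈ edges (W i) → ¬ e ∈ C
  some-walk-avoids {l} W disjoint C |C|<l with all? (meets? C ∘ W)
  ... | no ¬allHit =
    let (i , ¬hit) = ¬∀⟶∃¬ l _ (meets? C ∘ W) ¬allHit in i , λ e∈Wᵢ e∈C → ¬hit (lose e∈C e∈Wᵢ)
  ... | yes hit with pigeonhole |C|<l (Any.index ∘ hit)
  ... | i , j , i<j , sameIndex =
    ⊥-elim (disjoint i j (<⇒≢ i<j) _ (lookup-index (hit i))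
             (subst (λ k → lookup C k ∈ edges (W j)) (sym sameIndex) (lookup-index (hit j))))

module _ {R R′ : Rel (Fin n) 0ℓ} (R⊆R′ : ∀ {x y} → R x y → R′ x y) {u v : Fin n} where

  disjointPaths-mono : ∀ {c} → DisjointPaths R u v c → DisjointPaths R′ u v c
  disjointPaths-mono (P , disjoint) = P′ , λ i j i≢j e e∈i e∈j →
    disjoint i j i≢j e (subst (e ∈_) (retype-edges (walk i) (steps i)) e∈i)
                       (subst (e ∈_) (retype-edges (walk j) (steps j)) e∈j)
    where
      walk = proj₁ ∘ P
      steps : ∀ i {x y} → (x , y) ∈ edges (walk i) → R′ x y
      steps i = R⊆R′ ∘ ∈-edges⇒R (walk i)
      P′ : Fin _ → SimplePath R′ u v
      P′ i = retypePath (P i) (steps i)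

Exits : (Fin n → Set) → Edge n → Set
Exits S (x , y) = S x × ¬ S y

module _ {R : Rel (Fin n) 0ℓ} (S : Fin n → Set) where

  exit-edge : Decidable S → ∀ {u t} → S u → ¬ S t → (p : Walk R u t) → ∃ λ e → e ∈ edges p × Exits S e
  exit-edge S? Su ¬St nil = ⊥-elim (¬St Su)
  exit-edge S? Su ¬St (cons {w = w} r p) with S? w
  ... | yes Sw = let (e , e∈p , exits) = exit-edge S? Sw ¬St p in e , there e∈p , exits
  ... | no ¬Sw = _ , here refl , Su , ¬Sw

  NeverReenters : ∀ {u t} → Walk R u t → Set
  NeverReenters p = ∀ {x y} → (x , y) ∈ edges p → ¬ S x → ¬ S y

  stays-outside : ∀ {u t} (p : Walk R u t) → NeverReenters p → ¬ S u →
                  ∀ {e} → e ∈ edges p → ¬ S (proj₁ e)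
  stays-outside (cons r p) never ¬Su (here refl) = ¬Su
  stays-outside (cons r p) never ¬Su (there e∈p) =
    stays-outside p (never ∘ there) (never (here refl) ¬Su) e∈p

  exit-edge-unique : ∀ {u t} (p : Walk R u t) → NeverReenters p →
                     ∀ {e e′} → e ∈ edges p → e′ ∈ edges p → Exits S e → Exits S e′ → e ≡ e′
  exit-edge-unique (cons r p) never (here refl) (here refl) _ _ = refl
  exit-edge-unique (cons r p) never (here refl) (there e′∈p) (_ , ¬Sw) (Se′ , _) =
    ⊥-elim (stays-outside p (never ∘ there) ¬Sw e′∈p Se′)
  exit-edge-unique (cons r p) never (there e∈p) (here refl) (Se , _) (_ , ¬Sw) =
    ⊥-elim (stays-outside p (never ∘ there) ¬Sw e∈p Se)
  exit-edge-unique (cons r p) never (there e∈p) (there e′∈p) exits exits′ =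
    exit-edge-unique p (never ∘ there) e∈p e′∈p exits exits′

unique⇒length≤ : {xs : List (Fin n)} → Unique xs → length xs ≤ n
unique⇒length≤ uxs = injective⇒≤ (lookup-injective uxs)
  where
    lookup-injective : ∀ {xs : List (Fin n)} → Unique xs → Injective _≡_ _≡_ (lookup xs)
    lookup-injective (_ ∷ _) {zero} {zero} _ = refl
    lookup-injective (x∉xs ∷ _) {zero} {suc j} x≡xsⱼ = ⊥-elim (All.lookup x∉xs (∈-lookup j) x≡xsⱼ)
    lookup-injective (x∉xs ∷ _) {suc i} {zero} xsᵢ≡x = ⊥-elim (All.lookup x∉xs (∈-lookup i) (sym xsᵢ≡x))
    lookup-injective (_ ∷ uxs) {suc i} {suc j} eq = cong suc (lookup-injective uxs eq)

module _ {R : Rel (Fin n) 0ℓ} (R? : ∀ x y → Dec (R x y)) where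

  length-verts : ∀ {u v} (p : Walk R u v) → length (verts p) ≡ suc (length (edges p))
  length-verts nil = refl
  length-verts (cons r p) = cong suc (length-verts p)

  ShortWalk : ℕ → Fin n → Fin n → Set
  ShortWalk k u t = Σ (Walk R u t) (λ p → length (edges p) ≤ k)

  shortWalk? : ∀ k u t → Dec (ShortWalk k u t)
  shortWalk? k u t with u ≟ t
  ... | yes refl = yes (nil , z≤n)
  shortWalk? zero u t | no u≢t = no λ { (nil , _) → u≢t refl ; (cons _ _ , ()) }
  shortWalk? (suc k) u t | no u≢t =
    map′ (λ (w , r , p , p≤k) → cons r p , s≤s p≤k) firstStep
         (any? λ w → R? u w ×-dec shortWalk? k w t)
    where
      firstStep : ShortWalk (suc k) u t → ∃ λ w → R u w × ShortWalk k w t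
      firstStep (nil , _) = ⊥-elim (u≢t refl)
      firstStep (cons r p , s≤s p≤k) = _ , r , p , p≤k

  -- A simple path has fewer than n edges, so searching walks of length ≤ n suffices.
  reachable? : ∀ u t → Dec (Walk R u t)
  reachable? u t = map′ proj₁ (λ p → shorten (proj₁ (simplify p))) (shortWalk? n u t)
    where
      shorten : SimplePath R u t → ShortWalk n u t
      shorten (q , uq) = q , <⇒≤ (subst (_≤ n) (length-verts q) (unique⇒length≤ uq))

module _ {R : Rel (Fin n) 0ℓ} where

  insertWalk : ∀ {u w} → Digraph n → Walk R u w → Digraph n
  insertWalk g nil = g
  insertWalk g (cons {u} {w} _ p) = insertWalk g p [ (u , w) ]≔ true

  ∈E-insertWalk⁻ : ∀ {u w} {g : Digraph n} (p : Walk R u w) {e} → e ∈E insertWalk g p → e ∈ edges p ⊎ e ∈E g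
  ∈E-insertWalk⁻ nil e∈g = inj₂ e∈g
  ∈E-insertWalk⁻ (cons r p) {e} e∈g′ with ∈E-insert⁻ e e∈g′
  ... | inj₁ refl = inj₁ (here refl)
  ... | inj₂ e∈g″ = Sum.map₁ there (∈E-insertWalk⁻ p e∈g″)

  ∈E-insertWalk⁺ : ∀ {u w} {g : Digraph n} (p : Walk R u w) {e} → e ∈ edges p ⊎ e ∈E g → e ∈E insertWalk g p
  ∈E-insertWalk⁺ nil (inj₂ e∈g) = e∈g
  ∈E-insertWalk⁺ (cons r p) {e} (inj₁ (here refl)) = ∈E-insert⁺ e (inj₁ refl)
  ∈E-insertWalk⁺ (cons r p) {e} (inj₁ (there e∈p)) = ∈E-insert⁺ e (inj₂ (∈E-insertWalk⁺ p (inj₁ e∈p)))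
  ∈E-insertWalk⁺ (cons r p) {e} (inj₂ e∈g) = ∈E-insert⁺ e (inj₂ (∈E-insertWalk⁺ p (inj₂ e∈g)))

  balanced-insertWalk : ∀ {u w} {g : Digraph n} {r q : Fin n → ℕ} (p : Walk R u w) → Unique (verts p) →
                        (∀ {e} → e ∈ edges p → e ∉E g) →
                        Balanced g (r +δ w) q → Balanced (insertWalk g p) (r +δ u) q
  balanced-insertWalk nil _ _ bal = bal
  balanced-insertWalk {g = g} (cons {u} {w₁} _ p) (u∉p ∷ up) fresh bal =
    balanced-insert {g = insertWalk g p} (¬-not new) (balanced-insertWalk p up (fresh ∘ there) bal)
    where
      new : ¬ (u , w₁) ∈E insertWalk g p
      new uw∈ with ∈E-insertWalk⁻ p uw∈
      ... | inj₁ uw∈p = All¬⇒¬Any u∉p (∈-edges⇒∈-verts p uw∈p)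
      ... | inj₂ uw∈g = not-¬ uw∈g (fresh (here refl))

module Decomposition {R : Rel (Fin n) 0ℓ} (s v : Fin n) where

  surplus-emits : ∀ c {g : Digraph n} {a} → a ≢ v → Balanced g ((c ·δ s) +δ a) (suc c ·δ v) → 0 < outdeg g a
  surplus-emits c {a = a} a≢v bal = balanced-source-emits bal a noDemand surplus
    where
      noDemand : suc c * δ v a ≡ 0
      noDemand = trans (cong (suc c *_) (δ-≢ (a≢v ∘ sym))) (*-zeroʳ (suc c))
      surplus : 0 < c * δ s a + δ a a
      surplus = subst (λ t → 0 < c * δ s a + t) (sym (δ-refl a)) (subst (0 <_) (+-comm 1 _) (s≤s z≤n))

  -- Walk along edges of g from a, deleting each one: every deletion moves the
  -- surplus unit of supply along, so until v is reached an out-edge exists.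
  peel : ∀ fuel c {g : Digraph n} {a} → size g < fuel → g ⊆E R →
         Balanced g ((c ·δ s) +δ a) (suc c ·δ v) →
         Σ (Digraph n) λ g′ → g′ ⊆G g × IsFlow s v c g′ ×
           Σ (Walk R a v) λ w → ∀ {e} → e ∈ edges w → e ∈E g × e ∉E g′
  peel (suc fuel) c {g} {a} (s≤s size≤) g⊆R bal with a ≟ v
  ... | yes refl =
    g , (λ _ _ → id) ,
    balanced-cancelδ a (balanced-cong (λ _ → refl) (λ x → +-comm (δ a x) (c * δ a x)) bal) ,
    nil , λ ()
  ... | no a≢v with out-neighbour g a (surplus-emits c a≢v bal)
  ... | y , ay∈g with peel fuel c (<-≤-trans (delete-shrinks {g = g} ay∈g) size≤)
                         (g⊆R ∘ delete-⊆ g (a , y) _ _) (balanced-delete {g = g} ay∈g bal)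
  ... | g′ , g′⊆g₁ , flow , w , w-edges =
    g′ , (λ x z → delete-⊆ g (a , y) x z ∘ g′⊆g₁ x z) , flow , cons (g⊆R ay∈g) w ,
    λ { (here refl) → ay∈g , ¬-not (λ ay∈g′ → not-¬ (g′⊆g₁ a y ay∈g′) ([]≔-same g a y false))
      ; (there e∈w) → delete-⊆ g (a , y) _ _ (proj₁ (w-edges e∈w)) , proj₂ (w-edges e∈w) }

  decompose : ∀ c {f : Digraph n} → f ⊆E R → IsFlow s v c f →
              Σ (Fin c → Walk R s v) λ P → PairwiseEdgeDisjoint P × (∀ i {e} → e ∈ edges (P i) → e ∈E f)
  decompose zero _ _ = (λ ()) , (λ ()) , (λ ())
  decompose (suc c) {f} f⊆R flow
    with peel (suc (size f)) c ≤-refl f⊆R (balanced-cong (λ x → +-comm (δ s x) (c * δ s x)) (λ _ → refl) flow)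
  ... | g′ , g′⊆f , flow′ , w , w-edges with decompose c (f⊆R ∘ g′⊆f _ _) flow′
  ... | Q , Q-disjoint , Q⊆g′ = P , disjoint , P⊆f
    where
      P : Fin (suc c) → Walk R s v
      P zero = w
      P (suc i) = Q i

      disjoint : PairwiseEdgeDisjoint P
      disjoint zero zero 0≢0 = ⊥-elim (0≢0 refl)
      disjoint zero (suc j) _ e e∈w e∈Qj = not-¬ (Q⊆g′ j e∈Qj) (proj₂ (w-edges e∈w))
      disjoint (suc i) zero _ e e∈Qi e∈w = not-¬ (Q⊆g′ i e∈Qi) (proj₂ (w-edges e∈w))
      disjoint (suc i) (suc j) i≢j = Q-disjoint i j (i≢j ∘ cong suc)

      P⊆f : ∀ i {e} → e ∈ edges (P i) → e ∈E f
      P⊆f zero e∈w = proj₁ (w-edges e∈w)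
      P⊆f (suc i) e∈Qi = g′⊆f _ _ (Q⊆g′ i e∈Qi)

module Menger {D : Rel (Fin n) 0ℓ} (D? : ∀ x y → Dec (D x y)) (s v : Fin n) where

  NoCutBelow : ℕ → Set
  NoCutBelow l = ∀ (C : List (Edge n)) → length C < l → (∀ {e} → e ∈ C → D (proj₁ e) (proj₂ e)) →
                 Σ (Walk D s v) λ w → ∀ {e} → e ∈ edges w → ¬ e ∈ C

  union : ∀ {c} → (Fin c → SimplePath D s v) → Digraph n
  union {zero} P = λ _ _ → false
  union {suc c} P = insertWalk (union (P ∘ suc)) (proj₁ (P zero))

  ∈E-union⁻ : ∀ {c} (P : Fin c → SimplePath D s v) {e} → e ∈E union P → ∃ λ i → e ∈ edges (proj₁ (P i))
  ∈E-union⁻ {suc c} P e∈U with ∈E-insertWalk⁻ (proj₁ (P zero)) e∈U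
  ... | inj₁ e∈P₀ = zero , e∈P₀
  ... | inj₂ e∈U′ = Product.map suc id (∈E-union⁻ (P ∘ suc) e∈U′)

  ∈E-union⁺ : ∀ {c} (P : Fin c → SimplePath D s v) i {e} → e ∈ edges (proj₁ (P i)) → e ∈E union P
  ∈E-union⁺ {suc c} P zero e∈P₀ = ∈E-insertWalk⁺ (proj₁ (P zero)) (inj₁ e∈P₀)
  ∈E-union⁺ {suc c} P (suc i) e∈Pᵢ = ∈E-insertWalk⁺ (proj₁ (P zero)) (inj₂ (∈E-union⁺ (P ∘ suc) i e∈Pᵢ))

  union-⊆E : ∀ {c} (P : Fin c → SimplePath D s v) → union P ⊆E D
  union-⊆E P e∈U = let (i , e∈Pᵢ) = ∈E-union⁻ P e∈U in ∈-edges⇒R (proj₁ (P i)) e∈Pᵢ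

  isFlow-union : ∀ {c} ((P , _) : DisjointPaths D s v c) → IsFlow s v c (union P)
  isFlow-union {zero} _ _ = refl
  isFlow-union {suc c} (P , disjoint) =
    isFlow-suc {s = s} {v} {c} (balanced-insertWalk (proj₁ (P zero)) (proj₂ (P zero)) fresh)
      (isFlow-union (P ∘ suc , λ i j i≢j → disjoint (suc i) (suc j) (i≢j ∘ suc-injective)))
    where
      fresh : ∀ {e} → e ∈ edges (proj₁ (P zero)) → e ∉E union (P ∘ suc)
      fresh {e} e∈P₀ = ¬-not λ e∈U →
        let (i , e∈Pᵢ) = ∈E-union⁻ (P ∘ suc) e∈U in disjoint zero (suc i) (λ ()) e e∈P₀ e∈Pᵢ

  Residual : Digraph n → Rel (Fin n) 0ℓ
  Residual f x y = (D x y × (x , y) ∉E f) ⊎ (y , x) ∈E f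

  residual? : ∀ f x y → Dec (Residual f x y)
  residual? f x y = (D? x y ×-dec (f x y ≟ᴮ false)) ⊎-dec (f y x ≟ᴮ true)

  augment : ∀ {u w} (f : Digraph n) → Walk (Residual f) u w → Digraph n
  augment f nil = f
  augment f (cons {u} {w} (inj₁ _) p) = augment f p [ (u , w) ]≔ true
  augment f (cons {u} {w} (inj₂ _) p) = augment f p [ (w , u) ]≔ false

  augment-off : ∀ {u w} (f : Digraph n) (p : Walk (Residual f) u w) {x y} → ¬ x ∈ verts p →
                augment f p x y ≡ f x y × augment f p y x ≡ f y x
  augment-off f nil x∉p = refl , refl
  augment-off f (cons step p) x∉p with augment-off f p (x∉p ∘ there) | ∉-verts-cons step p x∉p | step
  ... | off₁ , off₂ | x≢u , x≢w | inj₁ _ = trans ([]≔-other (augment f p) (x≢u ∘ cong proj₁)) off₁ ,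
                                           trans ([]≔-other (augment f p) (x≢w ∘ cong proj₂)) off₂
  ... | off₁ , off₂ | x≢u , x≢w | inj₂ _ = trans ([]≔-other (augment f p) (x≢w ∘ cong proj₁)) off₁ ,
                                           trans ([]≔-other (augment f p) (x≢u ∘ cong proj₂)) off₂

  augment-⊆E : ∀ {u w} {f : Digraph n} (p : Walk (Residual f) u w) → f ⊆E D → augment f p ⊆E D
  augment-⊆E nil f⊆D = f⊆D
  augment-⊆E (cons {u} {w} (inj₁ (d , _)) p) f⊆D {x} {y} xy∈ with ∈E-insert⁻ (x , y) xy∈
  ... | inj₁ refl = d
  ... | inj₂ xy∈′ = augment-⊆E p f⊆D xy∈′
  augment-⊆E {f = f} (cons {u} {w} (inj₂ _) p) f⊆D {x} {y} xy∈ =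
    augment-⊆E p f⊆D (delete-⊆ (augment f p) (w , u) x y xy∈)

  balanced-augment : ∀ {u w} {f : Digraph n} {r q : Fin n → ℕ} (p : Walk (Residual f) u w) →
                     Unique (verts p) → Balanced f (r +δ w) q → Balanced (augment f p) (r +δ u) q
  balanced-augment nil _ bal = bal
  balanced-augment {f = f} (cons {u} {w₁} (inj₁ (_ , uw∉f)) p) (u∉p ∷ up) bal =
    balanced-insert {g = augment f p} (trans (proj₁ (augment-off f p (All¬⇒¬Any u∉p))) uw∉f)
      (balanced-augment p up bal)
  balanced-augment {f = f} (cons {u} {w₁} (inj₂ wu∈f) p) (u∉p ∷ up) bal =
    balanced-delete {g = augment f p} (trans (proj₂ (augment-off f p (All¬⇒¬Any u∉p))) wu∈f)
      (balanced-augment p up bal)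

  augmentingPath : ∀ {l j} → NoCutBelow l → j < l → ((P , _) : DisjointPaths D s v j) →
                   Walk (Residual (union P)) s v
  augmentingPath noCut j<l (P , _) with reachable? (residual? (union P)) s v
  ... | yes q = q
  ... | no ¬q = ⊥-elim blocked
    where
      f = union P
      S : Fin n → Set
      S = Walk (Residual f) s

      neverReenters : ∀ i → NeverReenters S (proj₁ (P i))
      neverReenters i xy∈Pᵢ ¬Sx Sy = ¬Sx (Sy ▷ inj₂ (∈E-union⁺ P i xy∈Pᵢ))

      exitOf : ∀ i → ∃ λ e → e ∈ edges (proj₁ (P i)) × Exits S e
      exitOf i = exit-edge S (reachable? (residual? f) s) nil ¬q (proj₁ (P i))

      C : List (Edge n)
      C = tabulate (proj₁ ∘ exitOf)

      C⊆D : ∀ {e} → e ∈ C → D (proj₁ e) (proj₂ e)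
      C⊆D e∈C with ∈-tabulate⁻ e∈C
      ... | i , refl = ∈-edges⇒R (proj₁ (P i)) (proj₁ (proj₂ (exitOf i)))

      blocked : ⊥
      blocked with noCut C (subst (_< _) (sym (length-tabulate _)) j<l) C⊆D
      ... | w , w-avoids with exit-edge S (reachable? (residual? f) s) nil ¬q w
      ... | e , e∈w , Se₁ , ¬Se₂ with f (proj₁ e) (proj₂ e) ≟ᴮ true
      ... | no e∉f = ¬Se₂ (Se₁ ▷ inj₁ (∈-edges⇒R w e∈w , ¬-not e∉f))
      ... | yes e∈f with ∈E-union⁻ P e∈f
      ... | i , e∈Pᵢ = w-avoids e∈w (subst (_∈ C) (sym e≡exit) (∈-tabulate⁺ i))
        where
          e≡exit : e ≡ proj₁ (exitOf i)
          e≡exit = exit-edge-unique S (proj₁ (P i)) (neverReenters i)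
                     e∈Pᵢ (proj₁ (proj₂ (exitOf i))) (Se₁ , ¬Se₂) (proj₂ (proj₂ (exitOf i)))

  augmentPaths : ∀ {l j} → NoCutBelow l → j < l → DisjointPaths D s v j → DisjointPaths D s v (suc j)
  augmentPaths {j = j} noCut j<l P with simplify (augmentingPath noCut j<l P)
  ... | (q , uq) , _ with Decomposition.decompose s v (suc j) (augment-⊆E q (union-⊆E (proj₁ P)))
                            (isFlow-suc {s = s} {v} {j} (balanced-augment q uq) (isFlow-union P))
  ... | W , W-disjoint , _ = simplify-disjoint W W-disjoint

  menger : ∀ {l} → NoCutBelow l → ∀ j → j ≤ l → DisjointPaths D s v j
  menger noCut zero _ = (λ ()) , (λ ())
  menger noCut (suc j) j<l = augmentPaths noCut j<l (menger noCut j (<⇒≤ j<l))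

module _ {G : Digraph n} {F C : List (Edge n)} {x y : Fin n} where

  minus-++ : EdgeOfMinus G F x y → ¬ (x , y) ∈ C → EdgeOfMinus G (F ++ C) x y
  minus-++ (xy∈G , xy∉F) xy∉C = xy∈G , Sum.[ xy∉F , xy∉C ] ∘ ∈-++⁻ F

  minus-++⇒minus : EdgeOfMinus G (F ++ C) x y → EdgeOfMinus G F x y
  minus-++⇒minus (xy∈G , xy∉F++C) = xy∈G , xy∉F++C ∘ ∈-++⁺ˡ

edgeOfMinus? : (G : Digraph n) (F : List (Edge n)) → ∀ x y → Dec (EdgeOfMinus G F x y)
edgeOfMinus? G F x y = (G x y ≟ᴮ true) ×-dec ¬? (anyᴸ? ((x , y) ≟E_) F)

ftrs⇒noCutBelow : {G H : Digraph n} {s v : Fin n} {k l : ℕ} {F : List (Edge n)} →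
                  FTRS (k + l) G H s → FaultSet k G F → DisjPaths (suc l) G F s v →
                  Menger.NoCutBelow (edgeOfMinus? H F) s v (suc l)
ftrs⇒noCutBelow {G = G} {H} {s} {v} {k} {l} {F} (H⊆G , ftrs) (|F|≤k , F⊆G) (Q , Q-disjoint)
                C |C|≤l C⊆H−F
  with some-walk-avoids (proj₁ ∘ Q) Q-disjoint C |C|≤l
... | i , Qᵢ-avoids = proj₁ hPath , hPath-avoids
  where
    gPath : Path G (F ++ C) s v
    gPath = retypePath (Q i) λ xy∈Qᵢ → minus-++ {G = G} (∈-edges⇒R (proj₁ (Q i)) xy∈Qᵢ) (Qᵢ-avoids xy∈Qᵢ)

    faults : FaultSet (k + l) G (F ++ C)
    faults = subst (_≤ k + l) (sym (length-++ F)) (+-mono-≤ |F|≤k (s≤s⁻¹ |C|≤l)) ,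
             ++⁺ F⊆G (All.tabulate λ e∈C → H⊆G _ _ (proj₁ (C⊆H−F e∈C)))

    hPath′ : Path H (F ++ C) s v
    hPath′ = proj₁ (ftrs (F ++ C) faults v) gPath

    hPath : Path H F s v
    hPath = retypePath hPath′ (minus-++⇒minus {G = H} ∘ ∈-edges⇒R (proj₁ hPath′))

    hPath-avoids : ∀ {e} → e ∈ edges (proj₁ hPath) → ¬ e ∈ C
    hPath-avoids {e} e∈hPath e∈C =
      proj₂ (∈-edges⇒R (proj₁ hPath′) (subst (e ∈_) (retype-edges (proj₁ hPath′) _) e∈hPath))
            (∈-++⁺ʳ F e∈C)

lemma3 : (n : ℕ) (G H : Digraph n) (s : Fin n) (k l : ℕ) → 1 ≤ l →
    FTRS (k + l ∸ 1) G H s → LFTRS l k G H s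
lemma3 n G H s k (suc l) _ ftrs@(H⊆G , _) =
  H⊆G , λ F faults v →
    (λ paths → Menger.menger (edgeOfMinus? H F) s v (ftrs⇒noCutBelow ftrs′ faults paths) (suc l) ≤-refl) ,
    disjointPaths-mono (Product.map₁ (H⊆G _ _))
  where
    ftrs′ : FTRS (k + l) G H s
    ftrs′ = subst (λ t → FTRS t G H s) (+-∸-assoc k (s≤s z≤n)) ftrs
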